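{- Let $X\subseteq\omega$ be an infinite set with uniqueness of sums and let $p\in\beta\omega$ be an $X$-adequate ultrafilter. Then every element $u$ of $\mathscr F^p$ generates a free subsemigroup, i.e. for all $n,m\in\mathbb N$, $u^n=u^m$ iff $n=m$.
   Context: $\mathrm{FS}(A)$ is the set of sums of finite nonempty subsets of $A$. $A\subseteq\omega$ has uniqueness of sums if whenever $a_1<\dots<a_n$, $b_1<\dots<b_m$ in $A$ have equal sums, $n=m$ and $a_i=b_i$. For infinite $X$ with increasing enumeration $\langle x_n\rangle$, $A$ is $X$-adequate if $A\subseteq\mathrm{FS}(X)$ and for every subsequence $\langle x_{n_k}:k\ge1\rangle$ there is a unique $m\ge1$ with $x_{n_1}+\dots+x_{n_m}\in A$; an ultrafilter $u$ is $X$-adequate if some $X$-adequate set is in $u$ and $\mathrm{FS}(Y)\in u$ for every cofinite $Y\subseteq X$. $u+v=\{B : \{x : \{y : x+y\in B\}\in v\}\in u\}$, $u^n=u+\cdots+u$. $\bigoplus_u u_n=\{B\subseteq\omega : \{n : \{m : n+m\in B\}\in u_n\}\in u\}$. $\mathscr F^p_0=\{p\}$, $\mathscr F^p_{\alpha+1}=\{\bigoplus_u u_n : u,u_n\in\mathscr F^p_\alpha\}$, unions at limit ordinals, $\mathscr F^p=\bigcup_\alpha\mathscr F^p_\alpha$. -}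

module Defs where

open import Data.Nat using (ℕ; zero; suc; _+_; _<_; _≤_)
open import Data.List using (List; []; _∷_)
open import Data.Nat.ListAction using (sum)
open import Data.List.Relation.Unary.All using (All)
open import Data.List.Relation.Unary.Linked using (Linked)
open import Data.Product using (Σ; ∃; _×_; _,_)
open import Data.Sum using (_⊎_)
open import Data.Unit using (⊤)
open import Data.Empty using (⊥)
open import Relation.Nullary using (¬_)
open import Relation.Binary.PropositionalEquality using (_≡_; _≢_)
open import Function.Bundles using (_⇔_)

SubsetN : Set₁
SubsetN = ℕ → Set

_⊆ₛ_ : SubsetN → SubsetN → Set
A ⊆ₛ B = ∀ {x} → A x → B x

-- A (candidate) point of βω: a family of subsets of ℕ.
Filt : Set₁
Filt = SubsetN → Set

record IsUltrafilter (u : Filt) : Set₁ where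
  field
    upward : ∀ {A B} → A ⊆ₛ B → u A → u B
    inter  : ∀ {A B} → u A → u B → u (λ x → A x × B x)
    full   : u (λ _ → ⊤)
    proper : ¬ u (λ _ → ⊥)
    ultra  : ∀ A → u A ⊎ u (λ x → ¬ A x)

_≈F_ : Filt → Filt → Set₁
u ≈F v = ∀ B → u B ⇔ v B

_⊞_ : Filt → Filt → Filt
(u ⊞ v) B = u (λ x → v (λ y → B (x + y)))

-- u^n for n ≥ 1 (u^1 = u, u^(n+1) = u + u^n); u^0 is the principal ultrafilter at 0
-- (only used with n ≥ 1).
pow : Filt → ℕ → Filt
pow u zero B = B 0
pow u (suc zero) = u
pow u (suc (suc n)) = u ⊞ pow u (suc n)

⊕ : Filt → (ℕ → Filt) → Filt
⊕ u us B = u (λ n → us n (λ m → B (n + m)))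

IncList : List ℕ → Set
IncList = Linked _<_

NonEmpty : List ℕ → Set
NonEmpty [] = ⊥
NonEmpty (_ ∷ _) = ⊤

-- FS(A): sums of finite nonempty subsets of A.
FS : SubsetN → SubsetN
FS A z = Σ (List ℕ) λ l → NonEmpty l × IncList l × All A l × sum l ≡ z

UniqueSums : SubsetN → Set
UniqueSums A = ∀ l l' → NonEmpty l → NonEmpty l' → IncList l → IncList l'
  → All A l → All A l' → sum l ≡ sum l' → l ≡ l'

StrictInc : (ℕ → ℕ) → Set
StrictInc f = ∀ i j → i < j → f i < f j

-- An infinite X ⊆ ω is given by its increasing enumeration x; X = range x.
Range : (ℕ → ℕ) → SubsetN
Range x z = ∃ λ n → x n ≡ z

partialSum : (ℕ → ℕ) → (ℕ → ℕ) → ℕ → ℕ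
partialSum x ns zero = 0
partialSum x ns (suc m) = partialSum x ns m + x (ns m)

Adequate : (ℕ → ℕ) → SubsetN → Set
Adequate x A = (A ⊆ₛ FS (Range x)) ×
  (∀ ns → StrictInc ns →
     Σ ℕ λ m → 1 ≤ m × A (partialSum x ns m) ×
       (∀ m' → 1 ≤ m' → A (partialSum x ns m') → m' ≡ m))

FiniteSet : SubsetN → Set
FiniteSet S = Σ ℕ λ b → ∀ z → S z → z < b

AdequateUF : (ℕ → ℕ) → Filt → Set₁
AdequateUF x u =
  (Σ SubsetN λ A → Adequate x A × u A) ×
  (∀ (Y : SubsetN) → Y ⊆ₛ Range x → FiniteSet (λ z → Range x z × ¬ Y z) → u (FS Y))

-- 𝓕^p: least family containing p and closed under (u, ⟨u_n⟩) ↦ ⊕_u u_n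
-- (= ⋃_α 𝓕^p_α).
data InF (p : Filt) : Filt → Set₁ where
  base : InF p p
  step : ∀ u us → InF p u → (∀ n → InF p (us n)) → InF p (⊕ u us)

{-# OPTIONS --safe #-}
module Submission where

-- Every u ∈ 𝓕^p is tail adequate: for some set A, along each increasing index sequence at most
-- one initial segment has its x-sum in A (an A-block), and for every N the sums of A-blocks of
-- sequences above N form a member of u. For p this is X-adequacy. It passes to ⊕_u u_k with the
-- blocks "an A-block followed by an A_k-block, k the sum of the first", because by uniqueness of
-- sums a sum determines its index sequence. Splicing sequences shows that u^n contains the set of
-- sums of n consecutive A-blocks, and by uniqueness of sums and of block lengths these sets are
-- disjoint for different n, so u^n ≠ u^m when n ≠ m.

open import Defs
open import Data.Nat using (ℕ; _≤_)
open import Relation.Binary.PropositionalEquality using (_≡_)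
open import Function.Bundles using (_⇔_)

open import Data.Nat using (zero; suc; _+_; _<_; _∸_; s≤s; z≤n; _≟_; _<?_; _≤?_)
open import Data.Nat.Properties
open import Data.Nat.ListAction using (sum)
open import Data.List using (List; []; _∷_)
open import Data.List.Properties using (∷-injectiveˡ; ∷-injectiveʳ)
open import Data.List.Relation.Unary.All as All using (All; []; _∷_)
open import Data.List.Relation.Unary.Linked using ([]; [-]; _∷_)
open import Data.List.Relation.Unary.Linked.Properties using (Linked⇒All)
open import Data.Product using (Σ; _×_; _,_; proj₁)
open import Data.Empty using (⊥; ⊥-elim)
open import Function.Bundles using (mk⇔; Equivalence)
open import Function.Construct.Identity using (⇔-id)
open import Relation.Binary using (tri<; tri≈; tri>)
open import Relation.Binary.PropositionalEquality using (refl; sym; trans; cong; cong₂; subst; module ≡-Reasoning)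
open import Relation.Nullary using (¬_; yes; no)
open import Relation.Nullary.Decidable using (decidable-stable)

record IsProperFilter (u : Filt) : Set₁ where
  field
    upward : ∀ {A B} → A ⊆ₛ B → u A → u B
    inter  : ∀ {A B} → u A → u B → u (λ z → A z × B z)
    proper : ¬ u (λ _ → ⊥)

  member-inhabited : ∀ {A} → u A → ¬ (∀ z → ¬ A z)
  member-inhabited u∋A A-empty = proper (upward (λ {z} → A-empty z) u∋A)

isUltrafilter⇒isProperFilter : ∀ {u} → IsUltrafilter u → IsProperFilter u
isUltrafilter⇒isProperFilter U = record { upward = upward ; inter = inter ; proper = proper }
  where open IsUltrafilter U

⊕-isProperFilter : ∀ {u us} → IsProperFilter u → (∀ k → IsProperFilter (us k))
  → IsProperFilter (⊕ u us)
⊕-isProperFilter F Fs = record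
  { upward = λ A⊆B → F.upward (λ {k} → upward (Fs k) A⊆B)
  ; inter  = λ u∋A u∋B → F.upward (λ {k} (a , b) → inter (Fs k) a b) (F.inter u∋A u∋B)
  ; proper = λ u∋∅ → F.proper (F.upward (λ {k} us∋∅ → ⊥-elim (proper (Fs k) us∋∅)) u∋∅)
  }
  where
  module F = IsProperFilter F
  open IsProperFilter

pow-isProperFilter : ∀ {u} → IsProperFilter u → ∀ k → IsProperFilter (pow u (suc k))
pow-isProperFilter F zero    = F
pow-isProperFilter F (suc k) = ⊕-isProperFilter F (λ _ → pow-isProperFilter F k)

Agree : ℕ → (ℕ → ℕ) → (ℕ → ℕ) → Set
Agree t f g = ∀ i → i < t → f i ≡ g i

Above : ℕ → (ℕ → ℕ) → Set
Above N f = ∀ i → N ≤ f i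

drop : ℕ → (ℕ → ℕ) → ℕ → ℕ
drop s f i = f (s + i)

splice : ℕ → (ℕ → ℕ) → (ℕ → ℕ) → ℕ → ℕ
splice s f g i with i <? s
... | yes _ = f i
... | no  _ = g (i ∸ s)

Agree-≤ : ∀ {s t f g} → s ≤ t → Agree t f g → Agree s f g
Agree-≤ s≤t fg i i<s = fg i (<-≤-trans i<s s≤t)

Agree-drop : ∀ s {r f g} → Agree (s + r) f g → Agree r (drop s f) (drop s g)
Agree-drop s fg i i<r = fg (s + i) (+-monoʳ-< s i<r)

splice-agree : ∀ s f g → Agree s f (splice s f g)
splice-agree s f g i i<s with i <? s
... | yes _   = refl
... | no  i≮s = ⊥-elim (i≮s i<s)

drop-splice : ∀ s f g i → drop s (splice s f g) i ≡ g i
drop-splice s f g i with s + i <? s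
... | yes s+i<s = ⊥-elim (m+n≮m s i s+i<s)
... | no  _     = cong g (m+n∸m≡n s i)

drop-strictInc : ∀ s {f} → StrictInc f → StrictInc (drop s f)
drop-strictInc s f-inc i j i<j = f-inc (s + i) (s + j) (+-monoʳ-< s i<j)

splice-strictInc : ∀ s {f g} → StrictInc f → StrictInc g → Above (f s) g
  → StrictInc (splice s f g)
splice-strictInc s f-inc g-inc g≥fs i j i<j with i <? s | j <? s
... | yes _   | yes _   = f-inc i j i<j
... | yes i<s | no  _   = <-≤-trans (f-inc i s i<s) (g≥fs (j ∸ s))
... | no  i≮s | yes j<s = ⊥-elim (i≮s (<-trans i<j j<s))
... | no  i≮s | no  _   = g-inc (i ∸ s) (j ∸ s) (∸-monoˡ-< i<j (≮⇒≥ i≮s))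

splice-above : ∀ {N} s {f g} → Above N f → Above N g → Above N (splice s f g)
splice-above s f≥N g≥N i with i <? s
... | yes _ = f≥N i
... | no  _ = g≥N (i ∸ s)

+-above : ∀ {N i} → N ≤ i → Above N (_+ i)
+-above {i = i} N≤i j = ≤-trans N≤i (m≤n+m i j)

+-strictInc : ∀ i → StrictInc (_+ i)
+-strictInc i _ _ = +-monoˡ-< i

strictInc-injective : ∀ {f} → StrictInc f → ∀ {i j} → f i ≡ f j → i ≡ j
strictInc-injective f-inc {i} {j} fi≡fj with <-cmp i j
... | tri< i<j _ _ = ⊥-elim (<-irrefl fi≡fj (f-inc i j i<j))
... | tri≈ _ i≡j _ = i≡j
... | tri> _ _ j<i = ⊥-elim (<-irrefl (sym fi≡fj) (f-inc j i j<i))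

strictInc-cancel-< : ∀ {f} → StrictInc f → ∀ {i j} → f i < f j → i < j
strictInc-cancel-< f-inc {i} {j} fi<fj with <-cmp i j
... | tri< i<j _ _  = i<j
... | tri≈ _ refl _ = ⊥-elim (<-irrefl refl fi<fj)
... | tri> _ _ j<i  = ⊥-elim (<-asym fi<fj (f-inc j i j<i))

PrefixPred : Set₁
PrefixPred = (ℕ → ℕ) → ℕ → Set

Local : PrefixPred → Set
Local P = ∀ {t f g} → Agree t f g → P f t → P g t

Positive : PrefixPred → Set
Positive P = ∀ {f t} → P f t → 1 ≤ t

UniqueLength : PrefixPred → Set
UniqueLength P = ∀ {f s s′} → StrictInc f → P f s → P f s′ → s ≡ s′

NonEmptyPrefix : PrefixPred
NonEmptyPrefix _ t = 1 ≤ t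

module _ (x : ℕ → ℕ) where

  open ≡-Reasoning

  partialSum-+ : ∀ f s r
    → partialSum x f (s + r) ≡ partialSum x f s + partialSum x (drop s f) r
  partialSum-+ f s zero = begin
    partialSum x f (s + 0)      ≡⟨ cong (partialSum x f) (+-identityʳ s) ⟩
    partialSum x f s            ≡⟨ +-identityʳ _ ⟨
    partialSum x f s + 0        ∎
  partialSum-+ f s (suc r) = begin
    partialSum x f (s + suc r)
      ≡⟨ cong (partialSum x f) (+-suc s r) ⟩
    partialSum x f (s + r) + x (f (s + r))
      ≡⟨ cong (_+ x (f (s + r))) (partialSum-+ f s r) ⟩
    partialSum x f s + partialSum x (drop s f) r + x (f (s + r))
      ≡⟨ +-assoc (partialSum x f s) _ _ ⟩
    partialSum x f s + partialSum x (drop s f) (suc r)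
      ∎

  partialSum-cong : ∀ {f g} t → Agree t f g → partialSum x f t ≡ partialSum x g t
  partialSum-cong zero    _  = refl
  partialSum-cong (suc t) fg =
    cong₂ _+_ (partialSum-cong t (Agree-≤ (n≤1+n t) fg)) (cong x (fg t (n<1+n t)))

  partialSum-splice : ∀ s f g r
    → partialSum x (splice s f g) (s + r) ≡ partialSum x f s + partialSum x g r
  partialSum-splice s f g r = begin
    partialSum x (splice s f g) (s + r)
      ≡⟨ partialSum-+ (splice s f g) s r ⟩
    partialSum x (splice s f g) s + partialSum x (drop s (splice s f g)) r
      ≡⟨ cong₂ _+_ (sym (partialSum-cong s (splice-agree s f g)))
                   (partialSum-cong r (λ i _ → drop-splice s f g i)) ⟩
    partialSum x f s + partialSum x g r
      ∎

  Block : SubsetN → PrefixPred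
  Block A f s = 1 ≤ s × A (partialSum x f s)

  record Then (P : PrefixPred) (Q : ℕ → PrefixPred) (f : ℕ → ℕ) (t : ℕ) : Set where
    constructor split
    field
      s r   : ℕ
      head  : P f s
      tail  : Q (partialSum x f s) (drop s f) r
      s+r≡t : s + r ≡ t

  Parse : SubsetN → ℕ → PrefixPred
  Parse A zero    = λ _ t → t ≡ 0
  Parse A (suc k) = Then (Block A) (λ _ → Parse A k)

  record PrefixSums (N : ℕ) (P : PrefixPred) (z : ℕ) : Set where
    constructor prefixSum
    field
      seq        : ℕ → ℕ
      above      : Above N seq
      increasing : StrictInc seq
      length     : ℕ
      prefix     : P seq length
      sum≡       : partialSum x seq length ≡ z

  Block-local : ∀ A → Local (Block A)
  Block-local A {t} fg (1≤t , a) = 1≤t , subst A (partialSum-cong t fg) a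

  Then-local : ∀ {P Q} → Local P → (∀ k → Local (Q k)) → Local (Then P Q)
  Then-local {Q = Q} P-local Q-local fg (split s r p q refl) =
    split s r (P-local fg-s p)
      (subst (λ k → Q k _ r) (partialSum-cong s fg-s) (Q-local _ (Agree-drop s fg) q)) refl
    where
    fg-s : Agree s _ _
    fg-s = Agree-≤ (m≤m+n s r) fg

  Then-positive : ∀ {P Q} → Positive P → Positive (Then P Q)
  Then-positive P-pos (split s r p _ refl) = ≤-trans (P-pos p) (m≤m+n s r)

  Then-unique : ∀ {P Q} → UniqueLength P → (∀ k → UniqueLength (Q k))
    → UniqueLength (Then P Q)
  Then-unique P-unique Q-unique f-inc (split s r p q refl) (split _ _ p′ q′ refl)
    with P-unique f-inc p p′
  ... | refl = cong (s +_) (Q-unique _ (drop-strictInc s f-inc) q q′)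

  Parse-local : ∀ A k → Local (Parse A k)
  Parse-local A zero    _ t≡0 = t≡0
  Parse-local A (suc k) = Then-local (Block-local A) (λ _ → Parse-local A k)

  Parse-positive : ∀ A k → Positive (Parse A (suc k))
  Parse-positive A k = Then-positive proj₁

  Block⇒Parse₁ : ∀ {A f t} → Block A f t → Parse A 1 f t
  Block⇒Parse₁ {t = t} b = split t 0 b refl (+-identityʳ t)

  Parse-count-unique : ∀ {A f} → UniqueLength (Block A) → StrictInc f
    → ∀ {k k′ t} → Parse A k f t → Parse A k′ f t → k ≡ k′
  Parse-count-unique A-unique f-inc {zero}  {zero}  _ _ = refl
  Parse-count-unique A-unique f-inc {zero}  {suc _} refl (split _ _ (s≤s _ , _) _ ())
  Parse-count-unique A-unique f-inc {suc _} {zero}  (split _ _ (s≤s _ , _) _ ()) refl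
  Parse-count-unique {A} A-unique f-inc {suc k} {suc k′}
    (split s r b p refl) (split _ r′ b′ p′ s+r′≡s+r) with A-unique f-inc b b′
  ... | refl = cong suc (Parse-count-unique A-unique (drop-strictInc s f-inc) p
                 (subst (Parse A k′ _) (+-cancelˡ-≡ s r′ r s+r′≡s+r) p′))

  PrefixSums-mono : ∀ {N P P′} → (∀ {f t} → P f t → P′ f t) → PrefixSums N P ⊆ₛ PrefixSums N P′
  PrefixSums-mono P⇒P′ (prefixSum f f≥N f-inc t p e) = prefixSum f f≥N f-inc t (P⇒P′ p) e

  PrefixSums-Block : ∀ {N P} → Positive P → PrefixSums N P ⊆ₛ PrefixSums N (Block (PrefixSums 0 P))
  PrefixSums-Block P-pos (prefixSum f f≥N f-inc t p e) =
    prefixSum f f≥N f-inc t (P-pos p , prefixSum f (λ _ → z≤n) f-inc t p refl) e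

  splice-PrefixSums : ∀ {N P Q f s j} → Local P → (∀ k → Local (Q k))
    → Above N f → StrictInc f → P f s
    → PrefixSums (f s) (Q (partialSum x f s)) j
    → PrefixSums N (Then P Q) (partialSum x f s + j)
  splice-PrefixSums {N} {P} {Q} {f} {s} P-local Q-local f≥N f-inc p
    (prefixSum g g≥fs g-inc r q refl) =
    prefixSum h (splice-above s f≥N (λ i → ≤-trans (f≥N s) (g≥fs i)))
      (splice-strictInc s f-inc g-inc g≥fs)
      (s + r) (split s r (P-local (splice-agree s f g) p) q-spliced refl)
      (partialSum-splice s f g r)
    where
    h : ℕ → ℕ
    h = splice s f g
    q-spliced : Q (partialSum x h s) (drop s h) r
    q-spliced = subst (λ k → Q k (drop s h) r) (partialSum-cong s (splice-agree s f g))
                  (Q-local _ (λ i _ → sym (drop-splice s f g i)) q)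

  PrefixSums-⊕ : ∀ {u us P Q} → IsProperFilter u → (∀ k → IsProperFilter (us k))
    → Local P → (∀ k → Local (Q k))
    → (∀ N → u (PrefixSums N P)) → (∀ k N → us k (PrefixSums N (Q k)))
    → ∀ N → ⊕ u us (PrefixSums N (Then P Q))
  PrefixSums-⊕ {us = us} {P} {Q} F Fs P-local Q-local P-tails Q-tails N =
    IsProperFilter.upward F continue (P-tails N)
    where
    continue : PrefixSums N P ⊆ₛ (λ k → us k (λ j → PrefixSums N (Then P Q) (k + j)))
    continue (prefixSum f f≥N f-inc s p refl) =
      IsProperFilter.upward (Fs _) (splice-PrefixSums P-local Q-local f≥N f-inc p) (Q-tails _ (f s))

  -- What survives of X-adequacy under ⊕: block lengths are unique, but need not exist.
  record TailAdequate (u : Filt) : Set₁ where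
    field
      isProperFilter : IsProperFilter u
      blocks         : SubsetN
      blocks-unique  : UniqueLength (Block blocks)
      tails          : ∀ N → u (PrefixSums N (Block blocks))

  pow-Parse : ∀ {u} (U : TailAdequate u) k N
    → pow u (suc k) (PrefixSums N (Parse (TailAdequate.blocks U) (suc k)))
  pow-Parse U zero N =
    IsProperFilter.upward isProperFilter (PrefixSums-mono (Block⇒Parse₁ {blocks})) (tails N)
    where open TailAdequate U
  pow-Parse U (suc k) =
    PrefixSums-⊕ isProperFilter (λ _ → pow-isProperFilter isProperFilter k)
      (Block-local blocks) (λ _ → Parse-local blocks (suc k)) tails (λ _ → pow-Parse U k)
    where open TailAdequate U

  RangeFrom : ℕ → SubsetN
  RangeFrom N z = Σ ℕ λ i → N ≤ i × x i ≡ z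

  module _ (x-inc : StrictInc x) where

    RangeFrom-cofinite : ∀ N → FiniteSet (λ z → Range x z × ¬ RangeFrom N z)
    RangeFrom-cofinite N = x N , below
      where
      below : ∀ z → Range x z × ¬ RangeFrom N z → z < x N
      below _ ((i , refl) , ∉) with N ≤? i
      ... | yes N≤i = ⊥-elim (∉ (i , N≤i , refl))
      ... | no  N≰i = x-inc i N (≰⇒> N≰i)

    RangeFrom-suc : ∀ {i z} → x i < z → Range x z → RangeFrom (suc i) z
    RangeFrom-suc xi<z (j , refl) = j , strictInc-cancel-< x-inc xi<z , refl

    sum-PrefixSums : ∀ {N} l → NonEmpty l → IncList l → All (RangeFrom N) l
      → PrefixSums N NonEmptyPrefix (sum l)
    sum-PrefixSums (_ ∷ []) _ _ ((i , N≤i , refl) ∷ []) =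
      prefixSum (_+ i) (+-above N≤i) (+-strictInc i) 1 (s≤s z≤n) (sym (+-identityʳ (x i)))
    sum-PrefixSums (_ ∷ y ∷ l) _ (xi<y ∷ inc) ((i , N≤i , refl) ∷ rest) =
      PrefixSums-mono (Then-positive (λ 1≤s → 1≤s))
        (splice-PrefixSums (λ _ 1≤s → 1≤s) (λ _ _ 1≤r → 1≤r) (+-above N≤i) (+-strictInc i)
          (s≤s z≤n) (sum-PrefixSums (y ∷ l) _ inc rest-above-xi))
      where
      rest-above-xi : All (RangeFrom (suc i)) (y ∷ l)
      rest-above-xi = All.zipWith (λ (xi<z , (j , _ , e)) → RangeFrom-suc xi<z (j , e))
                        (Linked⇒All <-trans xi<y inc , rest)

    adequateUF⇒TailAdequate : ∀ {p} → IsUltrafilter p → AdequateUF x p → TailAdequate p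
    adequateUF⇒TailAdequate {p} p-ultra ((A , (_ , adequate) , p∋A) , p∋FS) = record
      { isProperFilter = F
      ; blocks         = A
      ; blocks-unique  = unique
      ; tails          = λ N →
          upward tail-block (inter (p∋FS (RangeFrom N) range (RangeFrom-cofinite N)) p∋A)
      }
      where
      F : IsProperFilter p
      F = isUltrafilter⇒isProperFilter p-ultra
      open IsProperFilter F

      unique : UniqueLength (Block A)
      unique {f} f-inc (1≤s , a) (1≤s′ , a′) with adequate f f-inc
      ... | _ , _ , _ , only = trans (only _ 1≤s a) (sym (only _ 1≤s′ a′))

      range : ∀ {N} → RangeFrom N ⊆ₛ Range x
      range (i , _ , e) = i , e

      tail-block : ∀ {N z} → FS (RangeFrom N) z × A z → PrefixSums N (Block A) z
      tail-block ((l , ne , inc , all , refl) , a) with sum-PrefixSums l ne inc all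
      ... | prefixSum f f≥N f-inc t 1≤t e = prefixSum f f≥N f-inc t (1≤t , subst A (sym e) a) e

    module _ (x-uniq : UniqueSums (Range x)) where

      terms : (ℕ → ℕ) → ℕ → List ℕ
      terms f zero    = []
      terms f (suc t) = x (f 0) ∷ terms (drop 1 f) t

      sum-terms : ∀ f t → sum (terms f t) ≡ partialSum x f t
      sum-terms f zero    = refl
      sum-terms f (suc t) =
        trans (cong (x (f 0) +_) (sum-terms (drop 1 f) t)) (sym (partialSum-+ f 1 t))

      terms-increasing : ∀ {f} t → StrictInc f → IncList (terms f t)
      terms-increasing zero          _     = []
      terms-increasing (suc zero)    _     = [-]
      terms-increasing (suc (suc t)) f-inc =
        x-inc _ _ (f-inc 0 1 (s≤s z≤n)) ∷ terms-increasing (suc t) (drop-strictInc 1 f-inc)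

      terms-in-range : ∀ f t → All (Range x) (terms f t)
      terms-in-range f zero    = []
      terms-in-range f (suc t) = (f 0 , refl) ∷ terms-in-range (drop 1 f) t

      terms-injective : ∀ {f g} t t′ → terms f t ≡ terms g t′ → t ≡ t′ × Agree t f g
      terms-injective zero    zero     _ = refl , λ _ ()
      terms-injective {f} {g} (suc t) (suc t′) e
        with terms-injective {drop 1 f} {drop 1 g} t t′ (∷-injectiveʳ e)
      ... | refl , tails-agree = refl , agree
        where
        agree : Agree (suc t) f g
        agree zero    _         = strictInc-injective x-inc (∷-injectiveˡ e)
        agree (suc i) (s≤s i<t) = tails-agree i i<t

      partialSum-injective : ∀ {f g t t′} → StrictInc f → StrictInc g → 1 ≤ t → 1 ≤ t′
        → partialSum x f t ≡ partialSum x g t′ → t ≡ t′ × Agree t f g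
      partialSum-injective {f} {g} {suc t} {suc t′} f-inc g-inc _ _ e =
        terms-injective (suc t) (suc t′)
          (x-uniq _ _ _ _ (terms-increasing (suc t) f-inc) (terms-increasing (suc t′) g-inc)
                  (terms-in-range f (suc t)) (terms-in-range g (suc t′)) sums-equal)
        where
        sums-equal : sum (terms f (suc t)) ≡ sum (terms g (suc t′))
        sums-equal = begin
          sum (terms f (suc t))      ≡⟨ sum-terms f (suc t) ⟩
          partialSum x f (suc t)     ≡⟨ e ⟩
          partialSum x g (suc t′)    ≡⟨ sum-terms g (suc t′) ⟨
          sum (terms g (suc t′))     ∎

      PrefixSums-reflect : ∀ {N P f t} → Local P → Positive P → StrictInc f → 1 ≤ t
        → PrefixSums N P (partialSum x f t) → P f t
      PrefixSums-reflect P-local P-pos f-inc 1≤t (prefixSum g _ g-inc _ p e)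
        with partialSum-injective g-inc f-inc (P-pos p) 1≤t e
      ... | refl , gf = P-local gf p

      ⊕-TailAdequate : ∀ {u us} → TailAdequate u → (∀ k → TailAdequate (us k))
        → TailAdequate (⊕ u us)
      ⊕-TailAdequate {u} {us} U Us = record
        { isProperFilter = F
        ; blocks         = PrefixSums 0 TwoBlocks
        ; blocks-unique  = λ f-inc b b′ → TwoBlocks-unique f-inc (reflect f-inc b) (reflect f-inc b′)
        ; tails          = λ N → IsProperFilter.upward F
            (λ {z} → PrefixSums-Block {N} {TwoBlocks} TwoBlocks-positive {z}) (TwoBlocks-tails N)
        }
        where
        open TailAdequate
        F : IsProperFilter (⊕ u us)
        F = ⊕-isProperFilter (isProperFilter U) (λ k → isProperFilter (Us k))

        TwoBlocks : PrefixPred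
        TwoBlocks = Then (Block (blocks U)) (λ k → Block (blocks (Us k)))

        TwoBlocks-local : Local TwoBlocks
        TwoBlocks-local = Then-local (Block-local (blocks U)) (λ k → Block-local (blocks (Us k)))

        TwoBlocks-tails : ∀ N → ⊕ u us (PrefixSums N TwoBlocks)
        TwoBlocks-tails = PrefixSums-⊕ (isProperFilter U) (λ k → isProperFilter (Us k))
          (Block-local (blocks U)) (λ k → Block-local (blocks (Us k))) (tails U) (λ k → tails (Us k))

        TwoBlocks-positive : Positive TwoBlocks
        TwoBlocks-positive = Then-positive proj₁

        TwoBlocks-unique : UniqueLength TwoBlocks
        TwoBlocks-unique = Then-unique (blocks-unique U) (λ k → blocks-unique (Us k))

        reflect : ∀ {f t} → StrictInc f → Block (PrefixSums 0 TwoBlocks) f t → TwoBlocks f t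
        reflect f-inc (1≤t , sum∈) =
          PrefixSums-reflect TwoBlocks-local TwoBlocks-positive f-inc 1≤t sum∈

      InF-TailAdequate : ∀ {p} → TailAdequate p → ∀ {u} → InF p u → TailAdequate u
      InF-TailAdequate p-tail base              = p-tail
      InF-TailAdequate p-tail (step _ _ v∈ vs∈) =
        ⊕-TailAdequate (InF-TailAdequate p-tail v∈) (λ k → InF-TailAdequate p-tail (vs∈ k))

      Parse-disjoint : ∀ {A} → UniqueLength (Block A) → ∀ {N N′ n m z}
        → PrefixSums N (Parse A (suc n)) z → PrefixSums N′ (Parse A (suc m)) z → n ≡ m
      Parse-disjoint {A} A-unique {n = n} {m} (prefixSum f _ f-inc t p refl) q =
        suc-injective (Parse-count-unique A-unique f-inc p
          (PrefixSums-reflect (Parse-local A (suc m)) (Parse-positive A m) f-inc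
             (Parse-positive A n p) q))

corollary2p16 : (x : ℕ → ℕ) → StrictInc x → UniqueSums (Range x)
    → (p : Filt) → IsUltrafilter p → AdequateUF x p
    → ∀ u → InF p u → ∀ n m → 1 ≤ n → 1 ≤ m
    → (pow u n ≈F pow u m) ⇔ (n ≡ m)
corollary2p16 x x-inc x-uniq p p-ultra p-adequate u u∈F (suc n) (suc m) _ _ =
  mk⇔ powers-equal⇒equal (λ { refl _ → ⇔-id _ })
  where
  U : TailAdequate x u
  U = InF-TailAdequate x x-inc x-uniq (adequateUF⇒TailAdequate x x-inc p-ultra p-adequate) u∈F
  open TailAdequate U
  open IsProperFilter (pow-isProperFilter isProperFilter m)

  powers-equal⇒equal : pow u (suc n) ≈F pow u (suc m) → suc n ≡ suc m
  powers-equal⇒equal u^n≈u^m = cong suc (decidable-stable (n ≟ m) λ n≢m →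
    member-inhabited
      (inter (Equivalence.to (u^n≈u^m _) (pow-Parse x U n 0)) (pow-Parse x U m 0))
      (λ _ (a , b) → n≢m (Parse-disjoint x x-inc x-uniq blocks-unique a b)))
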